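{- If $i\ge2$ and $c,d\in[i]$, then the vincular patterns $12\cdots i\text{ - }c$ and $12\cdots i\text{ - }d$ are Wilf-equivalent.
   Context: For $k\ge1$ let $[k]=\{1,\dots,k\}$; a $k$-ary word of length $n$ is an element of $[k]^n$. Two words are order-isomorphic if replacing the $i$-th smallest distinct letter by $i$ yields the same word. The vincular pattern $12\cdots i\text{ - }c$ (underlying word $12\cdots i\,c$) occurs in a word $w=w_1\cdots w_n$ if there are indices $p<p+1<\dots<p+i-1<q$ such that $w_pw_{p+1}\cdots w_{p+i-1}w_q$ is order-isomorphic to $12\cdots i\,c$ (i.e., the first $i$ letters of the occurrence are consecutive in $w$); otherwise $w$ avoids it. For a pattern $\sigma$, $a_\sigma(n,k)$ is the number of words in $[k]^n$ avoiding $\sigma$; $\sigma\sim\tau$ (Wilf-equivalence) means $a_\sigma(n,k)=a_\tau(n,k)$ for all $n\ge0,k\ge1$. -}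

module Defs where

open import Data.Nat using (ℕ; zero; suc; _+_; _≤_; _<_; _≟_; _<?_; _≤?_)
open import Data.Nat.Properties using () renaming (_≟_ to _≟ℕ_)
open import Data.Fin using (Fin; toℕ)
open import Data.Fin.Properties using (any?)
open import Data.List using (allFin; List; []; _∷_; [_]; map; _++_; take; drop; upTo; filter; deduplicate; length; concatMap)
open import Data.List.Properties using (≡-dec)
open import Data.Vec using (Vec; lookup; toList) renaming ([] to []ᵥ; _∷_ to _∷ᵥ_)

open import Data.Product using (Σ; ∃; _×_; _,_)
open import Relation.Nullary using (Dec; ¬_; ¬?)
open import Relation.Nullary.Decidable using (_×-dec_)
open import Relation.Binary.PropositionalEquality using (_≡_)

-- A k-ary word of length n: letters are Fin k (the order-preserving
-- relabelling of [k] = {1,..,k}).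
Word : ℕ → ℕ → Set
Word n k = Vec (Fin k) n

red : List ℕ → List ℕ
red u = map (λ x → suc (length (filter (_<? x) (deduplicate _≟ℕ_ u)))) u

OrderIso : List ℕ → List ℕ → Set
OrderIso u v = red u ≡ red v

patWord : ℕ → ℕ → List ℕ
patWord i c = map suc (upTo i) ++ [ c ]

letters : ∀ {n k} → Word n k → List ℕ
letters w = map toℕ (toList w)

Occurs : (i c : ℕ) → ∀ {n k} → Word n k → Set
Occurs i c {n} w =
  Σ (Fin n) λ p → Σ (Fin n) λ q →
    (toℕ p + i ≤ toℕ q) ×
    OrderIso (take i (drop (toℕ p) (letters w)) ++ [ toℕ (lookup w q) ]) (patWord i c)

Avoids : (i c : ℕ) → ∀ {n k} → Word n k → Set
Avoids i c w = ¬ Occurs i c w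

occurs? : (i c : ℕ) → ∀ {n k} (w : Word n k) → Dec (Occurs i c w)
occurs? i c w = any? λ p → any? λ q →
  (toℕ p + i ≤? toℕ q) ×-dec ≡-dec _≟ℕ_ _ _

avoids? : (i c : ℕ) → ∀ {n k} (w : Word n k) → Dec (Avoids i c w)
avoids? i c w = ¬? (occurs? i c w)

allWords : (n k : ℕ) → List (Word n k)
allWords zero k = []ᵥ ∷ []
allWords (suc n) k = concatMap (λ a → map (a ∷ᵥ_) (allWords n k)) (allFin k)

a : (i c n k : ℕ) → ℕ
a i c n k = length (filter (avoids? i c) (allWords n k))

WilfEquiv : (i c d : ℕ) → Set
WilfEquiv i c d = ∀ (n k : ℕ) → 1 ≤ k → a i c n k ≡ a i d n k

module Submission where

-- Reading a word from left to right, call a letter forbidden once it is the c-th letter of an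
-- ascending factor of length i that has been completed; the word avoids 12⋯i-c iff no letter is
-- forbidden when it is written. Whenever the final ascending run reaches length i or more,
-- exactly one letter becomes forbidden: it was still allowed, and it is not larger than the
-- letter just written. So the number of avoiding continuations of a prefix depends only on how
-- many letters are allowed, the rank of the last letter among them and the length of the final
-- ascending run, and these quantities evolve by a recursion in which c does not occur.

open import Defs
open import Data.Bool using (Bool; true; false; if_then_else_; not; _∧_; _∨_; T)
open import Data.Bool.Properties using (T-≡; T-∧; T-∨; ∨-assoc)
open import Data.Empty using (⊥; ⊥-elim)
open import Data.Fin using (Fin; toℕ; fromℕ<) renaming (zero to fzero; suc to fsuc)
open import Data.Fin.Properties using (toℕ<n; toℕ-fromℕ<)
open import Data.List using (List; []; _∷_; _++_; length; map; filter; concatMap; tabulate; allFin; take; drop; reverse; upTo; applyUpTo; deduplicate)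
open import Data.List.Properties
  using (++-assoc; ++-identityʳ; unfold-reverse; reverse-++; length-reverse; length-++; length-map; length-upTo; length-take; length-drop;
         take-take; take++drop≡id; drop-drop; drop-all; filter-accept; filter-reject; filter-all; filter-none; filter-++;
         map-cong; map-cong-local; map-∘; map-++; map-upTo; map-tabulate)
open import Data.List.Membership.Propositional using (_∈_)
open import Data.List.Membership.Propositional.Properties using (∈-deduplicate⁺; ∈-++⁺ˡ; ∈-++⁺ʳ)
open import Data.List.Relation.Unary.All as All using (All; []; _∷_)
open import Data.List.Relation.Unary.AllPairs as AllPairs using (AllPairs; []; _∷_)
open import Data.List.Relation.Unary.AllPairs.Properties using (++⁺)
open import Data.List.Relation.Unary.Any using (here; there)
open import Data.Nat using (ℕ; zero; suc; _+_; _∸_; _⊓_; _≤_; _<_; _≤ᵇ_; _<ᵇ_; _≡ᵇ_; z≤n; s≤s; z<s; _<?_; _≤?_; _≟_; pred)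
open import Data.Nat.ListAction using (sum)
open import Data.Nat.Properties
open import Data.Product using (∃; _×_; _,_; proj₁; proj₂)
open import Data.Sum using (inj₁; inj₂)
open import Data.Unit using (⊤; tt)
open import Data.Vec using (lookup) renaming ([] to []ᵥ; _∷_ to _∷ᵥ_)
open import Function using (_∘_; _⇔_; mk⇔; Equivalence)
open import Function.Construct.Composition using (_⇔-∘_)
open import Function.Construct.Symmetry using (⇔-sym)
open import Relation.Binary.Definitions using (tri<; tri≈; tri>)
open import Relation.Binary.PropositionalEquality
open import Relation.Nullary using (¬_; yes; no; ¬?)
open import Relation.Unary using (Decidable)

T-not⁺ : ∀ {b} → ¬ T b → T (not b)
T-not⁺ {true} ¬b = ¬b _
T-not⁺ {false} _ = _

T-not⁻ : ∀ {b} → T (not b) → ¬ T b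
T-not⁻ {true} ()
T-not⁻ {false} _ ()

<ᵇ-true : ∀ {m n} → m < n → (m <ᵇ n) ≡ true
<ᵇ-true m<n = Equivalence.to T-≡ (<⇒<ᵇ m<n)

<ᵇ-false : ∀ {m n} → n ≤ m → (m <ᵇ n) ≡ false
<ᵇ-false {m} {n} n≤m with m <ᵇ n in eq
... | true = ⊥-elim (<⇒≱ (<ᵇ⇒< m n (subst T (sym eq) _)) n≤m)
... | false = refl

≡ᵇ-refl : ∀ m → (m ≡ᵇ m) ≡ true
≡ᵇ-refl m = Equivalence.to T-≡ (≡⇒≡ᵇ m m refl)

≡ᵇ-false : ∀ {m n} → m ≢ n → (m ≡ᵇ n) ≡ false
≡ᵇ-false {m} {n} m≢n with m ≡ᵇ n in eq
... | true = ⊥-elim (m≢n (≡ᵇ⇒≡ m n (subst T (sym eq) _)))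
... | false = refl

infix 4 _∈ᵇ_

_∈ᵇ_ : ℕ → List ℕ → Bool
y ∈ᵇ [] = false
y ∈ᵇ (z ∷ zs) = (y ≡ᵇ z) ∨ (y ∈ᵇ zs)

∈ᵇ-++ : ∀ y xs ys → (y ∈ᵇ xs ++ ys) ≡ ((y ∈ᵇ xs) ∨ (y ∈ᵇ ys))
∈ᵇ-++ y [] ys = refl
∈ᵇ-++ y (x ∷ xs) ys rewrite ∈ᵇ-++ y xs ys = sym (∨-assoc (y ≡ᵇ x) (y ∈ᵇ xs) (y ∈ᵇ ys))

infixl 10 _!_

-- Total indexing: positions past the end read 0.
_!_ : List ℕ → ℕ → ℕ
[] ! _ = 0
(x ∷ xs) ! zero = x
(x ∷ xs) ! suc n = xs ! n

!-++ˡ : ∀ xs ys {m} → m < length xs → (xs ++ ys) ! m ≡ xs ! m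
!-++ˡ (x ∷ xs) ys {zero} _ = refl
!-++ˡ (x ∷ xs) ys {suc m} (s≤s m<) = !-++ˡ xs ys m<

!-++ʳ : ∀ xs ys m → (xs ++ ys) ! (length xs + m) ≡ ys ! m
!-++ʳ [] ys m = refl
!-++ʳ (x ∷ xs) ys m = !-++ʳ xs ys m

!-snoc-last : ∀ W y → (W ++ y ∷ []) ! length W ≡ y
!-snoc-last W y = trans (cong ((W ++ y ∷ []) !_) (sym (+-identityʳ _))) (!-++ʳ W (y ∷ []) 0)

!-map : ∀ (f : ℕ → ℕ) xs {m} → m < length xs → map f xs ! m ≡ f (xs ! m)
!-map f (x ∷ xs) {zero} _ = refl
!-map f (x ∷ xs) {suc m} (s≤s m<) = !-map f xs m<

!-applyUpTo : ∀ (f : ℕ → ℕ) n {m} → m < n → applyUpTo f n ! m ≡ f m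
!-applyUpTo f (suc n) {zero} _ = refl
!-applyUpTo f (suc n) {suc m} (s≤s m<) = !-applyUpTo (f ∘ suc) n m<

!-drop : ∀ j xs m → drop j xs ! m ≡ xs ! (j + m)
!-drop zero xs m = refl
!-drop (suc j) [] m = refl
!-drop (suc j) (x ∷ xs) m = !-drop j xs m

!-reverse : ∀ xs {j} → j < length xs → reverse xs ! j ≡ xs ! (length xs ∸ suc j)
!-reverse (x ∷ xs) {j} j< rewrite unfold-reverse x xs with m≤n⇒m<n∨m≡n (≤-pred j<)
... | inj₁ j<xs = begin
  (reverse xs ++ x ∷ []) ! j  ≡⟨ !-++ˡ (reverse xs) _ (subst (j <_) (sym (length-reverse xs)) j<xs) ⟩
  reverse xs ! j              ≡⟨ !-reverse xs j<xs ⟩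
  xs ! (length xs ∸ suc j)    ≡⟨ cong ((x ∷ xs) !_) (sym (∸-suc j<xs)) ⟩
  (x ∷ xs) ! (length xs ∸ j)  ∎
  where open ≡-Reasoning
        ∸-suc : ∀ {j m} → j < m → m ∸ j ≡ suc (m ∸ suc j)
        ∸-suc {zero} {suc m} _ = refl
        ∸-suc {suc j} {suc m} (s≤s j<m) = ∸-suc j<m
... | inj₂ refl = begin
  (reverse xs ++ x ∷ []) ! length xs            ≡⟨ cong ((reverse xs ++ x ∷ []) !_) (length-reverse xs) ⟨
  (reverse xs ++ x ∷ []) ! length (reverse xs)  ≡⟨ !-snoc-last (reverse xs) x ⟩
  x                                             ≡⟨ cong ((x ∷ xs) !_) (n∸n≡0 (length xs)) ⟨
  (x ∷ xs) ! (length xs ∸ length xs)            ∎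
  where open ≡-Reasoning

!-reverse-++ : ∀ W X {j} → j < length W → (reverse W ++ X) ! j ≡ W ! (length W ∸ suc j)
!-reverse-++ W X j< = trans (!-++ˡ (reverse W) X (subst (_ <_) (sym (length-reverse W)) j<)) (!-reverse W j<)

!-∈ : ∀ xs {m} → m < length xs → xs ! m ∈ xs
!-∈ (x ∷ xs) {zero} _ = here refl
!-∈ (x ∷ xs) {suc m} (s≤s m<) = there (!-∈ xs m<)

reverse-∷-++ : ∀ {A : Set} (x : A) xs R → reverse (x ∷ xs) ++ R ≡ reverse xs ++ x ∷ R
reverse-∷-++ x xs R = trans (cong (_++ R) (unfold-reverse x xs)) (++-assoc (reverse xs) (x ∷ []) R)

take-+ : ∀ {A : Set} p m (L : List A) → take (p + m) L ≡ take p L ++ take m (drop p L)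
take-+ zero m L = refl
take-+ (suc p) zero [] = refl
take-+ (suc p) (suc m) [] = refl
take-+ (suc p) m (x ∷ L) = cong (x ∷_) (take-+ p m L)

length-take-≤ : ∀ {A : Set} (L : List A) {q} → q ≤ length L → length (take q L) ≡ q
length-take-≤ L {q} q≤ = trans (length-take q L) (m≤n⇒m⊓n≡m q≤)

drop-reverse : ∀ {A : Set} (P : List A) {j} → j ≤ length P → drop j (reverse P) ≡ reverse (take (length P ∸ j) P)
drop-reverse P {j} j≤ = begin
  drop j (reverse P)                                       ≡⟨ cong (drop j ∘ reverse) (take++drop≡id t P) ⟨
  drop j (reverse (take t P ++ drop t P))                  ≡⟨ cong (drop j) (reverse-++ (take t P) (drop t P)) ⟩
  drop j (reverse (drop t P) ++ reverse (take t P))        ≡⟨ drop-exact (reverse (drop t P)) length-rest ⟩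
  reverse (take t P)                                       ∎
  where
  open ≡-Reasoning
  t = length P ∸ j
  length-rest : length (reverse (drop t P)) ≡ j
  length-rest = trans (length-reverse (drop t P)) (trans (length-drop t P) (m∸[m∸n]≡n j≤))
  drop-exact : ∀ xs {ys j} → length xs ≡ j → drop j (xs ++ ys) ≡ ys
  drop-exact [] refl = refl
  drop-exact (x ∷ xs) refl = drop-exact xs refl

countᵇ : ∀ {A : Set} → (A → Bool) → List A → ℕ
countᵇ p [] = 0
countᵇ p (x ∷ xs) = if p x then suc (countᵇ p xs) else countᵇ p xs

countᵇ-++ : ∀ {A : Set} (p : A → Bool) xs ys → countᵇ p (xs ++ ys) ≡ countᵇ p xs + countᵇ p ys
countᵇ-++ p [] ys = refl
countᵇ-++ p (x ∷ xs) ys with p x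
... | true = cong suc (countᵇ-++ p xs ys)
... | false = countᵇ-++ p xs ys

countᵇ-concatMap : ∀ {A B : Set} (p : B → Bool) (f : A → List B) xs →
  countᵇ p (concatMap f xs) ≡ sum (map (countᵇ p ∘ f) xs)
countᵇ-concatMap p f [] = refl
countᵇ-concatMap p f (x ∷ xs) =
  trans (countᵇ-++ p (f x) (concatMap f xs)) (cong (countᵇ p (f x) +_) (countᵇ-concatMap p f xs))

countᵇ-map : ∀ {A B : Set} (p : B → Bool) (f : A → B) xs → countᵇ p (map f xs) ≡ countᵇ (p ∘ f) xs
countᵇ-map p f [] = refl
countᵇ-map p f (x ∷ xs) with p (f x)
... | true = cong suc (countᵇ-map p f xs)
... | false = countᵇ-map p f xs

countᵇ-∧ : ∀ {A : Set} b (q : A → Bool) xs → countᵇ (λ x → b ∧ q x) xs ≡ (if b then countᵇ q xs else 0)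
countᵇ-∧ true q xs = refl
countᵇ-∧ false q [] = refl
countᵇ-∧ false q (x ∷ xs) = countᵇ-∧ false q xs

length-filter≡countᵇ : ∀ {A : Set} {P : A → Set} (P? : Decidable P) (p : A → Bool) →
  (∀ x → P x ⇔ T (p x)) → ∀ xs → length (filter P? xs) ≡ countᵇ p xs
length-filter≡countᵇ P? p P⇔p [] = refl
length-filter≡countᵇ P? p P⇔p (x ∷ xs) with P? x | p x in eq
... | yes Px | true = cong suc (length-filter≡countᵇ P? p P⇔p xs)
... | yes Px | false = ⊥-elim (subst T eq (Equivalence.to (P⇔p x) Px))
... | no ¬Px | true = ⊥-elim (¬Px (Equivalence.from (P⇔p x) (subst T (sym eq) _)))
... | no ¬Px | false = length-filter≡countᵇ P? p P⇔p xs

countBelow : ℕ → (ℕ → Bool) → ℕ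
countBelow zero P = 0
countBelow (suc m) P = if P m then suc (countBelow m P) else countBelow m P

countBelow-cong : ∀ m {P Q : ℕ → Bool} → (∀ y → y < m → P y ≡ Q y) → countBelow m P ≡ countBelow m Q
countBelow-cong zero P≡Q = refl
countBelow-cong (suc m) {P} {Q} P≡Q
  with P m | Q m | P≡Q m ≤-refl | countBelow-cong m {P} {Q} (λ y y<m → P≡Q y (m<n⇒m<1+n y<m))
... | true  | .true  | refl | ih = cong suc ih
... | false | .false | refl | ih = ih

countBelow-suc : ∀ P x → T (P x) → countBelow (suc x) P ≡ suc (countBelow x P)
countBelow-suc P x Px with P x
... | true = refl

countBelow-mono : ∀ P {m n} → m ≤ n → countBelow m P ≤ countBelow n P
countBelow-mono P {n = n} z≤n = z≤n
countBelow-mono P {suc m} {suc n} (s≤s m≤n) with m≤n⇒m<n∨m≡n m≤n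
... | inj₂ refl = ≤-refl
... | inj₁ m<n = ≤-trans (countBelow-mono P m<n) (step n)
  where
  step : ∀ n → countBelow n P ≤ countBelow (suc n) P
  step n with P n
  ... | true = n≤1+n _
  ... | false = ≤-refl

countBelow-<ᵇ : ∀ P x h → T (P x) → (countBelow x P <ᵇ countBelow (suc h) P) ≡ not (h <ᵇ x)
countBelow-<ᵇ P x h Px with h <ᵇ x in eq
... | true = <ᵇ-false (countBelow-mono P (<ᵇ⇒< h x (subst T (sym eq) _)))
... | false = <ᵇ-true (begin-strict
  countBelow x P        <⟨ n<1+n _ ⟩
  suc (countBelow x P)  ≡⟨ countBelow-suc P x Px ⟨
  countBelow (suc x) P  ≤⟨ countBelow-mono P (s≤s (≮⇒≥ (λ h<x → subst T eq (<⇒<ᵇ h<x)))) ⟩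
  countBelow (suc h) P  ∎)
  where open ≤-Reasoning

countBelow-remove : ∀ m z P → z < m → T (P z) →
  suc (countBelow m (λ y → not (y ≡ᵇ z) ∧ P y)) ≡ countBelow m P
countBelow-remove (suc m) z P (s≤s z≤m) Pz with m≤n⇒m<n∨m≡n z≤m
... | inj₂ refl rewrite ≡ᵇ-refl z | Equivalence.to T-≡ Pz =
  cong suc (countBelow-cong z (λ y y<z → cong (λ b → not b ∧ P y) (≡ᵇ-false (<⇒≢ y<z))))
... | inj₁ z<m rewrite ≡ᵇ-false {m} {z} (>⇒≢ z<m) with P m
...   | true = cong suc (countBelow-remove m z P z<m Pz)
...   | false = countBelow-remove m z P z<m Pz

countBelow-∉ᵇ-∷ : ∀ m z F → z < m → T (not (z ∈ᵇ F)) →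
  suc (countBelow m (λ y → not (y ∈ᵇ z ∷ F))) ≡ countBelow m (λ y → not (y ∈ᵇ F))
countBelow-∉ᵇ-∷ m z F z<m z∉F =
  trans (cong suc (countBelow-cong m (λ y _ → not-∨ (y ≡ᵇ z) (y ∈ᵇ F))))
        (countBelow-remove m z (λ y → not (y ∈ᵇ F)) z<m z∉F)
  where
  not-∨ : ∀ a b → not (a ∨ b) ≡ not a ∧ not b
  not-∨ true b = refl
  not-∨ false b = refl

sumBelow : ℕ → (ℕ → ℕ) → ℕ
sumBelow zero g = 0
sumBelow (suc m) g = sumBelow m g + g m

sumBelow-cong : ∀ m {f g : ℕ → ℕ} → (∀ x → x < m → f x ≡ g x) → sumBelow m f ≡ sumBelow m g
sumBelow-cong zero f≡g = refl
sumBelow-cong (suc m) f≡g = cong₂ _+_ (sumBelow-cong m (λ x x<m → f≡g x (m<n⇒m<1+n x<m))) (f≡g m ≤-refl)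

sumBelow-select : ∀ m (P : ℕ → Bool) (g : ℕ → ℕ) →
  sumBelow m (λ x → if P x then g (countBelow x P) else 0) ≡ sumBelow (countBelow m P) g
sumBelow-select zero P g = refl
sumBelow-select (suc m) P g with P m
... | true = cong (_+ g (countBelow m P)) (sumBelow-select m P g)
... | false = trans (+-identityʳ _) (sumBelow-select m P g)

sumBelow-suc : ∀ m g → sumBelow (suc m) g ≡ g 0 + sumBelow m (g ∘ suc)
sumBelow-suc zero g = +-comm 0 (g 0)
sumBelow-suc (suc m) g = trans (cong (_+ g (suc m)) (sumBelow-suc m g)) (+-assoc (g 0) _ _)

sum-map-allFin : ∀ m (g : ℕ → ℕ) → sum (map (g ∘ toℕ) (allFin m)) ≡ sumBelow m g
sum-map-allFin m g = trans (cong sum (map-tabulate {n = m} (λ j → j) (g ∘ toℕ))) (sum-tabulate m g)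
  where
  sum-tabulate : ∀ m g → sum (tabulate (g ∘ toℕ {m})) ≡ sumBelow m g
  sum-tabulate zero g = refl
  sum-tabulate (suc m) g = trans (cong (g 0 +_) (sum-tabulate m (g ∘ suc))) (sym (sumBelow-suc m g))

-- Order-isomorphism to 12⋯i c

Ascending : List ℕ → Set
Ascending W = ∀ j → suc j < length W → W ! j < W ! suc j

Ascending⇒AllPairs : ∀ W → Ascending W → AllPairs _<_ W
Ascending⇒AllPairs [] _ = []
Ascending⇒AllPairs (w ∷ W) asc = All-tabulate W (λ m m< → !-< 0 (suc m) (s≤s z≤n) (s≤s m<))
                               ∷ Ascending⇒AllPairs W (λ j → asc (suc j) ∘ s≤s)
  where
  !-< : ∀ a b → a < b → b < length (w ∷ W) → (w ∷ W) ! a < (w ∷ W) ! b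
  !-< a (suc b) (s≤s a≤b) b< with m≤n⇒m<n∨m≡n a≤b
  ... | inj₁ a<b = <-trans (!-< a b a<b (<-trans (n<1+n b) b<)) (asc b b<)
  ... | inj₂ refl = asc a b<
  All-tabulate : ∀ {P : ℕ → Set} xs → (∀ m → m < length xs → P (xs ! m)) → All P xs
  All-tabulate [] _ = []
  All-tabulate (x ∷ xs) p = p 0 (s≤s z≤n) ∷ All-tabulate xs (λ m → p (suc m) ∘ s≤s)

-- The rank used by red: red u ≡ map (suc ∘ rank (deduplicate _≟_ u)) u holds by refl.
rank : List ℕ → ℕ → ℕ
rank D x = length (filter (_<? x) D)

rank-∷-< : ∀ {d} D {x} → d < x → rank (d ∷ D) x ≡ suc (rank D x)
rank-∷-< D {x} d<x = cong length (filter-accept (_<? x) {xs = D} d<x)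

rank-∷-≮ : ∀ {d} D {x} → ¬ d < x → rank (d ∷ D) x ≡ rank D x
rank-∷-≮ D {x} d≮x = cong length (filter-reject (_<? x) {xs = D} d≮x)

rank-mono : ∀ D {a b} → a ≤ b → rank D a ≤ rank D b
rank-mono [] _ = z≤n
rank-mono (d ∷ D) {a} {b} a≤b with d <? a | d <? b
... | yes d<a | yes d<b rewrite rank-∷-< D d<a | rank-∷-< D d<b = s≤s (rank-mono D a≤b)
... | yes d<a | no d≮b = ⊥-elim (d≮b (<-≤-trans d<a a≤b))
... | no d≮a | yes d<b rewrite rank-∷-≮ D d≮a | rank-∷-< D d<b = m≤n⇒m≤1+n (rank-mono D a≤b)
... | no d≮a | no d≮b rewrite rank-∷-≮ D d≮a | rank-∷-≮ D d≮b = rank-mono D a≤b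

rank-∈-< : ∀ D {a b} → a ∈ D → a < b → rank D a < rank D b
rank-∈-< (d ∷ D) {a} {b} (here refl) a<b with d <? a | d <? b
... | yes d<d | _ = ⊥-elim (<-irrefl refl d<d)
... | no d≮a | yes d<b rewrite rank-∷-≮ D d≮a | rank-∷-< D d<b = s≤s (rank-mono D (<⇒≤ a<b))
... | no _ | no d≮b = ⊥-elim (d≮b a<b)
rank-∈-< (d ∷ D) {a} {b} (there a∈D) a<b with d <? a | d <? b
... | yes d<a | yes d<b rewrite rank-∷-< D d<a | rank-∷-< D d<b = s≤s (rank-∈-< D a∈D a<b)
... | yes d<a | no d≮b = ⊥-elim (d≮b (<-trans d<a a<b))
... | no d≮a | yes d<b rewrite rank-∷-≮ D d≮a | rank-∷-< D d<b = m≤n⇒m≤1+n (rank-∈-< D a∈D a<b)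
... | no d≮a | no d≮b rewrite rank-∷-≮ D d≮a | rank-∷-≮ D d≮b = rank-∈-< D a∈D a<b

map-rank-ascending : ∀ W → AllPairs _<_ W → map (rank W) W ≡ upTo (length W)
map-rank-ascending [] _ = refl
map-rank-ascending (w ∷ W) (w<W ∷ W↑) = cong₂ _∷_ rank-w rank-W
  where
  rank-w : rank (w ∷ W) w ≡ 0
  rank-w = trans (rank-∷-≮ W (<-irrefl refl))
                 (cong length (filter-none (_<? w) (All.map (λ w<x x<w → <-asym w<x x<w) w<W)))
  rank-W : map (rank (w ∷ W)) W ≡ applyUpTo suc (length W)
  rank-W = begin
    map (rank (w ∷ W)) W  ≡⟨ map-cong-local (All.map (rank-∷-< W) w<W) ⟩
    map (suc ∘ rank W) W  ≡⟨ map-∘ W ⟩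
    map suc (map (rank W) W) ≡⟨ cong (map suc) (map-rank-ascending W W↑) ⟩
    map suc (upTo (length W)) ≡⟨ map-upTo suc (length W) ⟩
    applyUpTo suc (length W) ∎
    where open ≡-Reasoning

rank-!-ascending : ∀ W → AllPairs _<_ W → ∀ {m} → m < length W → rank W (W ! m) ≡ m
rank-!-ascending W W↑ {m} m< = begin
  rank W (W ! m)           ≡⟨ !-map (rank W) W m< ⟨
  map (rank W) W ! m       ≡⟨ cong (_! m) (map-rank-ascending W W↑) ⟩
  upTo (length W) ! m      ≡⟨ !-applyUpTo (λ x → x) (length W) m< ⟩
  m                        ∎
  where open ≡-Reasoning

deduplicate-distinct : ∀ U → AllPairs _≢_ U → deduplicate _≟_ U ≡ U
deduplicate-distinct [] _ = refl
deduplicate-distinct (u ∷ U) (u∉U ∷ U!) rewrite deduplicate-distinct U U! =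
  cong (u ∷_) (filter-all (¬? ∘ (u ≟_)) u∉U)

deduplicate-snoc-∈ : ∀ W {y} → AllPairs _≢_ W → y ∈ W → deduplicate _≟_ (W ++ y ∷ []) ≡ W
deduplicate-snoc-∈ (w ∷ W) (w∉W ∷ W!) (here refl)
  rewrite deduplicate-distinct (W ++ w ∷ [])
            (++⁺ W! ([] ∷ []) (All.map (λ w′≢w → (w′≢w ∘ sym) ∷ []) w∉W))
        | filter-++ (¬? ∘ (w ≟_)) W (w ∷ [])
        | filter-all (¬? ∘ (w ≟_)) w∉W
        | filter-reject (¬? ∘ (w ≟_)) {w} {[]} (λ w≢w → w≢w refl)
  = cong (w ∷_) (++-identityʳ W)
deduplicate-snoc-∈ (w ∷ W) {y} (w∉W ∷ W!) (there y∈W)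
  rewrite deduplicate-snoc-∈ W W! y∈W = cong (w ∷_) (filter-all (¬? ∘ (w ≟_)) w∉W)

length-patWord-prefix : ∀ i → length (map suc (upTo i)) ≡ i
length-patWord-prefix i = trans (length-map suc (upTo i)) (length-upTo i)

!-upTo-suc : ∀ i {j} → j < i → map suc (upTo i) ! j ≡ suc j
!-upTo-suc i {j} j<i = trans (cong (_! j) (map-upTo suc i)) (!-applyUpTo suc i j<i)

!-patWord-< : ∀ i c {j} → j < i → patWord i c ! j ≡ suc j
!-patWord-< i c {j} j<i =
  trans (!-++ˡ (map suc (upTo i)) (c ∷ []) (subst (j <_) (sym (length-patWord-prefix i)) j<i)) (!-upTo-suc i j<i)

!-patWord-last : ∀ i c → patWord i c ! i ≡ c
!-patWord-last i c = trans (cong (patWord i c !_) (sym (length-patWord-prefix i))) (!-snoc-last (map suc (upTo i)) c)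

red-ascending-snoc : ∀ {i c} W {y} → length W ≡ i → Ascending W → c < i → y ≡ W ! c →
  red (W ++ y ∷ []) ≡ patWord i (suc c)
red-ascending-snoc {i} {c} W {y} refl W↑ c<i refl = begin
  red (W ++ y ∷ [])
    ≡⟨ cong (λ D → map (suc ∘ rank D) (W ++ y ∷ [])) (deduplicate-snoc-∈ W (AllPairs.map <⇒≢ ap) (!-∈ W c<i)) ⟩
  map (suc ∘ rank W) (W ++ y ∷ [])
    ≡⟨ map-++ (suc ∘ rank W) W (y ∷ []) ⟩
  map (suc ∘ rank W) W ++ suc (rank W y) ∷ []
    ≡⟨ cong₂ (λ xs r → xs ++ suc r ∷ []) ranks-W (rank-!-ascending W ap c<i) ⟩
  patWord i (suc c) ∎
  where
  open ≡-Reasoning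
  ap = Ascending⇒AllPairs W W↑
  ranks-W : map (suc ∘ rank W) W ≡ map suc (upTo (length W))
  ranks-W = trans (map-∘ W) (cong (map suc) (map-rank-ascending W ap))

red-patWord : ∀ {i c} → c < i → red (patWord i (suc c)) ≡ patWord i (suc c)
red-patWord {i} {c} c<i = red-ascending-snoc (map suc (upTo i)) (length-patWord-prefix i) ascending c<i
  (sym (!-upTo-suc i c<i))
  where
  ascending : Ascending (map suc (upTo i))
  ascending j sj< = let sj<i = subst (suc j <_) (length-patWord-prefix i) sj< in
    subst₂ _<_ (sym (!-upTo-suc i (<-trans (n<1+n j) sj<i))) (sym (!-upTo-suc i sj<i)) (n<1+n (suc j))

-- Read off the ranks in W ++ [y]: the letters of W have ranks 0, …, i-1, so W ascends,
-- and y shares the rank of W ! c.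
red≡patWord⇒ : ∀ {i c} W {y} → length W ≡ i → c < i → red (W ++ y ∷ []) ≡ patWord i (suc c) →
  Ascending W × y ≡ W ! c
red≡patWord⇒ {i} {c} W {y} refl c<i E = W↑ , y≡W!c
  where
  U = W ++ y ∷ []
  D = deduplicate _≟_ U
  W<U : length W < length U
  W<U = subst (length W <_) (sym (trans (length-++ W) (+-comm (length W) 1))) ≤-refl
  rank-U : ∀ {m} → m < length U → suc (rank D (U ! m)) ≡ patWord i (suc c) ! m
  rank-U m< = trans (sym (!-map (suc ∘ rank D) U m<)) (cong (_! _) E)
  rank-W : ∀ {j} → j < length W → rank D (W ! j) ≡ j
  rank-W j< = suc-injective (trans (cong (suc ∘ rank D) (sym (!-++ˡ W (y ∷ []) j<)))
                                   (trans (rank-U (<-trans j< W<U)) (!-patWord-< i (suc c) j<)))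
  rank-y : rank D y ≡ c
  rank-y = suc-injective (trans (cong (suc ∘ rank D) (sym (!-snoc-last W y)))
                                (trans (rank-U W<U) (!-patWord-last i (suc c))))
  W↑ : Ascending W
  W↑ j sj< = ≰⇒> λ W!sj≤W!j →
    1+n≰n (subst₂ _≤_ (rank-W sj<) (rank-W (<-trans (n<1+n j) sj<)) (rank-mono D W!sj≤W!j))
  y≡W!c : y ≡ W ! c
  y≡W!c with <-cmp y (W ! c)
  ... | tri≈ _ y≡ _ = y≡
  ... | tri< y< _ _ = ⊥-elim (<-irrefl (trans rank-y (sym (rank-W c<i)))
                        (rank-∈-< D (∈-deduplicate⁺ _≟_ (∈-++⁺ʳ W (here refl))) y<))
  ... | tri> _ _ y> = ⊥-elim (<-irrefl (trans (rank-W c<i) (sym rank-y))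
                        (rank-∈-< D (∈-deduplicate⁺ _≟_ (∈-++⁺ˡ (!-∈ W c<i))) y>))

-- Ascending runs read backwards

-- Applied to a reversed word, the length of the ascending run at its end.
descent : List ℕ → ℕ
descent [] = 0
descent (x ∷ []) = 1
descent (x ∷ y ∷ S) = if y <ᵇ x then suc (descent (y ∷ S)) else 1

descent≤length : ∀ S → descent S ≤ length S
descent≤length [] = z≤n
descent≤length (x ∷ []) = s≤s z≤n
descent≤length (x ∷ y ∷ S) = if≤ (y <ᵇ x) (s≤s (descent≤length (y ∷ S))) (s≤s z≤n)
  where
  if≤ : ∀ b {p q r} → p ≤ r → q ≤ r → (if b then p else q) ≤ r
  if≤ true p≤r _ = p≤r
  if≤ false _ q≤r = q≤r

descent-∷⁻ : ∀ x y S {b} → suc b < descent (x ∷ y ∷ S) → y < x × b < descent (y ∷ S)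
descent-∷⁻ x y S sb< with y <ᵇ x in eq
... | true = <ᵇ⇒< y x (subst T (sym eq) _) , ≤-pred sb<
... | false = ⊥-elim (<⇒≱ sb< (s≤s z≤n))

descent-∷⁺ : ∀ x y S → y < x → descent (x ∷ y ∷ S) ≡ suc (descent (y ∷ S))
descent-∷⁺ x y S y<x rewrite <ᵇ-true y<x = refl

descent-!-< : ∀ S {a b} → a < b → b < descent S → S ! b < S ! a
descent-!-≤-head : ∀ S {b} → b < descent S → S ! b ≤ S ! 0
descent-!-≤-head S {zero} _ = ≤-refl
descent-!-≤-head S {suc b} sb< = <⇒≤ (descent-!-< S z<s sb<)
descent-!-< (x ∷ []) {b = b} a<b (s≤s b<0) = ⊥-elim (<⇒≱ a<b (≤-trans b<0 z≤n))
descent-!-< (x ∷ y ∷ S) {zero} {suc b} _ sb< with descent-∷⁻ x y S sb<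
... | y<x , b< = ≤-<-trans (descent-!-≤-head (y ∷ S) b<) y<x
descent-!-< (x ∷ y ∷ S) {suc a} {suc b} (s≤s a<b) sb< = descent-!-< (y ∷ S) a<b (proj₂ (descent-∷⁻ x y S sb<))

DescendingPrefix : List ℕ → ℕ → Set
DescendingPrefix S m = ∀ j → suc j < m → S ! suc j < S ! j

≤descent⇔DescendingPrefix : ∀ m S → m ≤ length S → (m ≤ descent S ⇔ DescendingPrefix S m)
≤descent⇔DescendingPrefix m S m≤ =
  mk⇔ (λ m≤d j sj<m → descent-!-< S (n<1+n j) (≤-trans sj<m m≤d)) (from m S m≤)
  where
  from : ∀ m S → m ≤ length S → DescendingPrefix S m → m ≤ descent S
  from zero S _ _ = z≤n
  from (suc zero) (x ∷ []) _ _ = s≤s z≤n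
  from (suc zero) (x ∷ y ∷ S) _ _ with y <ᵇ x
  ... | true = s≤s z≤n
  ... | false = s≤s z≤n
  from (suc (suc m)) (x ∷ y ∷ S) (s≤s m≤) desc =
    subst (suc (suc m) ≤_) (sym (descent-∷⁺ x y S (desc 0 (s≤s (s≤s z≤n)))))
      (s≤s (from (suc m) (y ∷ S) m≤ (λ j → desc (suc j) ∘ s≤s)))

reflect-involutive : ∀ {n k} → k < n → n ∸ suc (n ∸ suc k) ≡ k
reflect-involutive {n} {k} k<n = trans (sym (pred[m∸n]≡m∸[1+n] n (n ∸ suc k))) (cong pred (m∸[m∸n]≡n k<n))

reflect-suc : ∀ {n k} → suc k < n → suc (n ∸ suc (suc k)) ≡ n ∸ suc k
reflect-suc {suc n} {zero} (s≤s (s≤s _)) = refl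
reflect-suc {suc n} {suc k} (s≤s sk<n) = reflect-suc sk<n

reflect-< : ∀ {n k} → k < n → n ∸ suc k < n
reflect-< {suc n} {k} _ = s≤s (m∸n≤m n k)

Ascending⇔DescendingPrefix : ∀ W X → Ascending W ⇔ DescendingPrefix (reverse W ++ X) (length W)
Ascending⇔DescendingPrefix W X = mk⇔ to from
  where
  n = length W
  module Pair {j} (sj<n : suc j < n) where
    r = n ∸ suc (suc j)
    r+1≡ : suc r ≡ n ∸ suc j
    r+1≡ = reflect-suc sj<n
    r+1<n : suc r < n
    r+1<n = subst (_< n) (sym r+1≡) (reflect-< (<-trans (n<1+n j) sj<n))
    upper : (reverse W ++ X) ! j ≡ W ! suc r
    upper = trans (!-reverse-++ W X (<-trans (n<1+n j) sj<n)) (cong (W !_) (sym r+1≡))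
    lower : (reverse W ++ X) ! suc j ≡ W ! r
    lower = !-reverse-++ W X sj<n
  to : Ascending W → DescendingPrefix (reverse W ++ X) n
  to W↑ j sj<n = subst₂ _<_ (sym lower) (sym upper) (W↑ r r+1<n)
    where open Pair sj<n
  from : DescendingPrefix (reverse W ++ X) n → Ascending W
  from W↓ j sj<n =
    subst₂ _<_ (trans lower (cong (W !_) r′≡j)) (trans upper (cong (λ m → W ! suc m) r′≡j)) (W↓ r r+1<n)
    where
    open Pair sj<n using (r; r+1≡; r+1<n)
    open Pair r+1<n using (upper; lower) renaming (r to r′)
    r′≡j : r′ ≡ j
    r′≡j = trans (cong (λ m → n ∸ suc m) r+1≡) (reflect-involutive (<-trans (n<1+n j) sj<n))

headRank : (ℕ → Bool) → List ℕ → ℕ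
headRank P [] = 0
headRank P (h ∷ _) = countBelow (suc h) P

descent-∷ : ∀ P R x → T (P x) →
  (if countBelow x P <ᵇ headRank P R then 1 else suc (descent R)) ≡ descent (x ∷ R)
descent-∷ P [] x Px = refl
descent-∷ P (h ∷ R) x Px rewrite countBelow-<ᵇ P x h Px with h <ᵇ x
... | true = refl
... | false = refl

-- A recursion in which c does not occur

-- continuations i n a s d counts the admissible extensions by n letters of a prefix with a
-- allowed letters, s of them ≤ its last letter, ending in an ascending run of length d.
-- Appending the t-th allowed letter starts a new run iff t < s; once the run has length
-- ≥ i, one allowed letter not above the new one becomes forbidden.
extend : ℕ → (ℕ → ℕ → ℕ → ℕ) → ℕ → ℕ → ℕ → ℕ → ℕ
extend i next a s d t =
  let d′ = if t <ᵇ s then 1 else suc d in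
  if i ≤ᵇ d′ then next (a ∸ 1) t d′ else next a (suc t) d′

continuations : ℕ → ℕ → ℕ → ℕ → ℕ → ℕ
continuations i zero a s d = 1
continuations i (suc n) a s d = sumBelow a (extend i (continuations i n) a s d)

-- The letters forbidden by 12⋯i-c

module Forbidden (i′ c′ : ℕ) (c′≤i′ : c′ ≤ i′) where

  -- The pattern is 12⋯i-c with i = suc i′ and c = suc c′. Prefixes are kept reversed, last
  -- letter first, so the c-th letter of a window formed by the last i letters sits at position e.
  i e : ℕ
  i = suc i′
  e = i′ ∸ c′

  e<i : e < i
  e<i = s≤s (m∸n≤m i′ c′)

  newlyForbidden : List ℕ → List ℕ
  newlyForbidden R = if i ≤ᵇ descent R then R ! e ∷ [] else []

  forbidden : List ℕ → List ℕ
  forbidden [] = []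
  forbidden (x ∷ R) = newlyForbidden (x ∷ R) ++ forbidden R

  allowed : List ℕ → ℕ → Bool
  allowed R y = not (y ∈ᵇ forbidden R)

  admissibleAfter : List ℕ → List ℕ → Bool
  admissibleAfter R [] = true
  admissibleAfter R (x ∷ u) = allowed R x ∧ admissibleAfter (x ∷ R) u

  Admissible : List ℕ → Set
  Admissible [] = ⊤
  Admissible (x ∷ R) = T (allowed R x) × Admissible R

  ∈ᵇ-newlyForbidden⁻ : ∀ {z} S → T (z ∈ᵇ newlyForbidden S) → i ≤ descent S × z ≡ S ! e
  ∈ᵇ-newlyForbidden⁻ {z} S z∈ with i ≤ᵇ descent S in eq
  ... | true = ≤ᵇ⇒≤ i _ (subst T (sym eq) _) , ≡ᵇ⇒≡ z (S ! e) (z≡ (Equivalence.to T-∨ z∈))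
    where
    z≡ : _ → T (z ≡ᵇ S ! e)
    z≡ (inj₁ p) = p
    z≡ (inj₂ ())

  ∈ᵇ-newlyForbidden⁺ : ∀ S → i ≤ descent S → T (S ! e ∈ᵇ newlyForbidden S)
  ∈ᵇ-newlyForbidden⁺ S i≤ rewrite <ᵇ-true i≤ | ≡ᵇ-refl (S ! e) = _

  ∈ᵇ-forbidden⁻ : ∀ {z} R → T (z ∈ᵇ forbidden R) → ∃ λ j → T (z ∈ᵇ newlyForbidden (drop j R))
  ∈ᵇ-forbidden⁻ {z} (x ∷ R) z∈ rewrite ∈ᵇ-++ z (newlyForbidden (x ∷ R)) (forbidden R)
    with Equivalence.to T-∨ z∈
  ... | inj₁ z∈new = 0 , z∈new
  ... | inj₂ z∈old with ∈ᵇ-forbidden⁻ R z∈old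
  ...   | j , z∈j = suc j , z∈j

  ∈ᵇ-forbidden⁺ : ∀ {z} R j → T (z ∈ᵇ newlyForbidden (drop j R)) → T (z ∈ᵇ forbidden R)
  ∈ᵇ-forbidden⁺ [] zero ()
  ∈ᵇ-forbidden⁺ [] (suc j) ()
  ∈ᵇ-forbidden⁺ {z} (x ∷ R) j z∈ rewrite ∈ᵇ-++ z (newlyForbidden (x ∷ R)) (forbidden R) with j
  ... | zero = Equivalence.from T-∨ (inj₁ z∈)
  ... | suc j = Equivalence.from T-∨ (inj₂ (∈ᵇ-forbidden⁺ R j z∈))

  Admissible-! : ∀ R → Admissible R → ∀ {m} → m < length R → T (allowed (drop (suc m) R) (R ! m))
  Admissible-! (x ∷ R) (x✓ , _) {zero} _ = x✓
  Admissible-! (x ∷ R) (_ , R✓) {suc m} (s≤s m<) = Admissible-! R R✓ m<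

  -- A window forbidding the letter z at position e of x ∷ R either lies wholly before z's
  -- position, so z was not allowed when written, or overlaps the ascending run containing z,
  -- where z cannot be the c-th letter of two different windows.
  newlyForbidden-allowed : ∀ R x → Admissible R → T (allowed R x) → i ≤ descent (x ∷ R) →
    T (allowed R ((x ∷ R) ! e))
  newlyForbidden-allowed R x R✓ x✓ i≤d = T-not⁺ λ z∈ →
    let (j , z∈j) = ∈ᵇ-forbidden⁻ R z∈ in
    let (i≤dj , z≡) = ∈ᵇ-newlyForbidden⁻ (drop j R) z∈j in
    no-earlier-window e j refl i≤dj z≡
    where
    forbidden-in : ∀ j {y} → i ≤ descent (drop j R) → y ≡ drop j R ! e → T (y ∈ᵇ newlyForbidden (drop j R))
    forbidden-in j i≤dj refl = ∈ᵇ-newlyForbidden⁺ (drop j R) i≤dj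
    no-earlier-window : ∀ n j → n ≡ e → i ≤ descent (drop j R) → (x ∷ R) ! n ≡ drop j R ! e → ⊥
    no-earlier-window zero j _ i≤dj x≡ = T-not⁻ x✓ (∈ᵇ-forbidden⁺ R j (forbidden-in j i≤dj x≡))
    no-earlier-window (suc n) j n+1≡e i≤dj R!n≡ with n <? j
    ... | yes n<j = T-not⁻ (Admissible-! R R✓ n<R) (∈ᵇ-forbidden⁺ (drop (suc n) R) (j ∸ suc n)
                      (subst (λ S → T (R ! n ∈ᵇ newlyForbidden S)) drop-j (forbidden-in j i≤dj R!n≡)))
      where
      n<R : n < length R
      n<R = ≤-pred (≤-trans (subst (_< i) (sym n+1≡e) e<i) (≤-trans i≤d (descent≤length (x ∷ R))))
      drop-j : drop j R ≡ drop (j ∸ suc n) (drop (suc n) R)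
      drop-j = trans (cong (λ k → drop k R) (sym (m+[n∸m]≡n n<j))) (sym (drop-drop (suc n) (j ∸ suc n) R))
    ... | no n≮j = <-irrefl (trans (sym R!n≡) R!n≡′) (descent-!-< (drop j R) n∸j<e (<-≤-trans e<i i≤dj))
      where
      n∸j<e : n ∸ j < e
      n∸j<e = subst (n ∸ j <_) n+1≡e (s≤s (m∸n≤m n j))
      R!n≡′ : R ! n ≡ drop j R ! (n ∸ j)
      R!n≡′ = sym (trans (!-drop j R (n ∸ j)) (cong (R !_) (m+[n∸m]≡n (≮⇒≥ n≮j))))

  module Counting (k : ℕ) where

    admissibleCount : List ℕ → ℕ → ℕ
    admissibleCount R n = countᵇ (λ w → admissibleAfter R (letters w)) (allWords n k)

    admissibleCount-suc : ∀ R n → admissibleCount R (suc n) ≡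
      sumBelow k (λ x → if allowed R x then admissibleCount (x ∷ R) n else 0)
    admissibleCount-suc R n = begin
      countᵇ p (concatMap (λ a → map (a ∷ᵥ_) (allWords n k)) (allFin k))
        ≡⟨ countᵇ-concatMap p _ (allFin k) ⟩
      sum (map (λ a → countᵇ p (map (a ∷ᵥ_) (allWords n k))) (allFin k))
        ≡⟨ cong sum (map-cong count-a (allFin k)) ⟩
      sum (map (g ∘ toℕ) (allFin k))
        ≡⟨ sum-map-allFin k g ⟩
      sumBelow k g ∎
      where
      open ≡-Reasoning
      p = λ (w : Word (suc n) k) → admissibleAfter R (letters w)
      g = λ x → if allowed R x then admissibleCount (x ∷ R) n else 0
      count-a : ∀ a → countᵇ p (map (a ∷ᵥ_) (allWords n k)) ≡ g (toℕ a)
      count-a a = trans (countᵇ-map p (a ∷ᵥ_) (allWords n k))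
        (countᵇ-∧ (allowed R (toℕ a)) (λ w → admissibleAfter (toℕ a ∷ R) (letters w)) (allWords n k))

    continuationsFrom : ℕ → List ℕ → ℕ
    continuationsFrom n R = continuations i n (countBelow k (allowed R)) (headRank (allowed R) R) (descent R)

    continuationsFrom-∷ : ∀ n R x → Admissible R → All (_< k) R → x < k → T (allowed R x) →
      continuationsFrom n (x ∷ R) ≡
      extend i (continuations i n) (countBelow k (allowed R)) (headRank (allowed R) R) (descent R) (countBelow x (allowed R))
    continuationsFrom-∷ n R x R✓ R<k x<k x✓ = begin
      continuationsFrom n (x ∷ R)
        ≡⟨ by-run-length ⟩
      (if i ≤ᵇ D then continuations i n (m ∸ 1) t D else continuations i n m (suc t) D)
        ≡⟨ cong (λ d → if i ≤ᵇ d then continuations i n (m ∸ 1) t d else continuations i n m (suc t) d)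
                (descent-∷ (allowed R) R x x✓) ⟨
      extend i (continuations i n) m (headRank (allowed R) R) (descent R) t ∎
      where
      open ≡-Reasoning
      m = countBelow k (allowed R)
      t = countBelow x (allowed R)
      D = descent (x ∷ R)
      by-run-length : continuationsFrom n (x ∷ R) ≡
        (if i ≤ᵇ D then continuations i n (m ∸ 1) t D else continuations i n m (suc t) D)
      by-run-length with i ≤? D
      ... | yes i≤D rewrite <ᵇ-true i≤D = cong₂ (λ a′ s′ → continuations i n a′ s′ D)
            (cong pred (countBelow-∉ᵇ-∷ k z (forbidden R) z<k z✓))
            (suc-injective (trans (countBelow-∉ᵇ-∷ (suc x) z (forbidden R) (s≤s z≤x) z✓)
                                  (countBelow-suc (allowed R) x x✓)))
        where
        z = (x ∷ R) ! e
        e<D : e < D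
        e<D = <-≤-trans e<i i≤D
        z✓ : T (allowed R z)
        z✓ = newlyForbidden-allowed R x R✓ x✓ i≤D
        z≤x : z ≤ x
        z≤x = descent-!-≤-head (x ∷ R) e<D
        z<k : z < k
        z<k = All.lookup (x<k ∷ R<k) (!-∈ (x ∷ R) (<-≤-trans e<D (descent≤length (x ∷ R))))
      ... | no i≰D rewrite <ᵇ-false (≤-pred (≰⇒> i≰D)) =
            cong (λ s′ → continuations i n m s′ D) (countBelow-suc (allowed R) x x✓)

    admissibleCount≡continuationsFrom : ∀ n R → Admissible R → All (_< k) R →
      admissibleCount R n ≡ continuationsFrom n R
    admissibleCount≡continuationsFrom zero R _ _ = refl
    admissibleCount≡continuationsFrom (suc n) R R✓ R<k = begin
      admissibleCount R (suc n)
        ≡⟨ admissibleCount-suc R n ⟩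
      sumBelow k (λ x → if allowed R x then admissibleCount (x ∷ R) n else 0)
        ≡⟨ sumBelow-cong k step ⟩
      sumBelow k (λ x → if allowed R x then next (countBelow x (allowed R)) else 0)
        ≡⟨ sumBelow-select k (allowed R) next ⟩
      continuationsFrom (suc n) R ∎
      where
      open ≡-Reasoning
      next = extend i (continuations i n) (countBelow k (allowed R)) (headRank (allowed R) R) (descent R)
      step : ∀ x → x < k → (if allowed R x then admissibleCount (x ∷ R) n else 0) ≡
                           (if allowed R x then next (countBelow x (allowed R)) else 0)
      step x x<k with allowed R x in eq
      ... | true = let x✓ = subst T (sym eq) _ in
        trans (admissibleCount≡continuationsFrom n (x ∷ R) (x✓ , R✓) (x<k ∷ R<k))
              (continuationsFrom-∷ n R x R✓ R<k x<k x✓)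
      ... | false = refl

  admissibleAfter⇔ : ∀ R u →
    T (admissibleAfter R u) ⇔ (∀ {q} → q < length u → T (allowed (reverse (take q u) ++ R) (u ! q)))
  admissibleAfter⇔ R u = mk⇔ (to R u) (from R u)
    where
    to : ∀ R u → T (admissibleAfter R u) → ∀ {q} → q < length u → T (allowed (reverse (take q u) ++ R) (u ! q))
    to R (x ∷ u) adm {zero} _ = proj₁ (Equivalence.to T-∧ adm)
    to R (x ∷ u) adm {suc q} (s≤s q<) = subst (λ S → T (allowed S (u ! q))) (sym (reverse-∷-++ x (take q u) R))
      (to (x ∷ R) u (proj₂ (Equivalence.to T-∧ adm)) q<)
    from : ∀ R u → (∀ {q} → q < length u → T (allowed (reverse (take q u) ++ R) (u ! q))) →
      T (admissibleAfter R u)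
    from R [] _ = tt
    from R (x ∷ u) ok = Equivalence.from T-∧ (ok {0} (s≤s z≤n) , from (x ∷ R) u λ {q} q< →
      subst (λ S → T (allowed S (u ! q))) (reverse-∷-++ x (take q u) R) (ok (s≤s q<)))

  ∉ᵇ-newlyForbidden-[] : ∀ {z} → ¬ T (z ∈ᵇ newlyForbidden [])
  ∉ᵇ-newlyForbidden-[] ()

  ∈ᵇ-forbidden-reverse⁻ : ∀ {z} P → T (z ∈ᵇ forbidden (reverse P)) →
    ∃ λ t → t ≤ length P × T (z ∈ᵇ newlyForbidden (reverse (take t P)))
  ∈ᵇ-forbidden-reverse⁻ {z} P z∈ with ∈ᵇ-forbidden⁻ (reverse P) z∈
  ... | j , z∈j with j ≤? length P
  ...   | yes j≤ = length P ∸ j , m∸n≤m _ j ,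
                     subst (λ S → T (z ∈ᵇ newlyForbidden S)) (drop-reverse P j≤) z∈j
  ...   | no j≰ = ⊥-elim (∉ᵇ-newlyForbidden-[] {z} (subst (λ S → T (z ∈ᵇ newlyForbidden S))
                    (drop-all j (reverse P) (subst (_≤ j) (sym (length-reverse P)) (<⇒≤ (≰⇒> j≰)))) z∈j))

  ∈ᵇ-forbidden-reverse⁺ : ∀ {z} P {t} → t ≤ length P → T (z ∈ᵇ newlyForbidden (reverse (take t P))) →
    T (z ∈ᵇ forbidden (reverse P))
  ∈ᵇ-forbidden-reverse⁺ {z} P {t} t≤ z∈ = ∈ᵇ-forbidden⁺ (reverse P) (length P ∸ t)
    (subst (λ S → T (z ∈ᵇ newlyForbidden S))
      (sym (trans (drop-reverse P (m∸n≤m (length P) t)) (cong (λ s → reverse (take s P)) (m∸[m∸n]≡n t≤))))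
      z∈)

  ∈ᵇ-newlyForbidden-window⇔ : ∀ W X {z} → length W ≡ i →
    T (z ∈ᵇ newlyForbidden (reverse W ++ X)) ⇔ (Ascending W × z ≡ W ! c′)
  ∈ᵇ-newlyForbidden-window⇔ W X {z} lw = mk⇔
    (λ z∈ → let (i≤d , z≡) = ∈ᵇ-newlyForbidden⁻ S z∈ in i≤d⇔W↑ .Equivalence.to i≤d , trans z≡ S!e)
    (λ { (W↑ , refl) → subst (λ y → T (y ∈ᵇ newlyForbidden S)) S!e
                              (∈ᵇ-newlyForbidden⁺ S (i≤d⇔W↑ .Equivalence.from W↑)) })
    where
    S = reverse W ++ X
    S!e : S ! e ≡ W ! c′
    S!e = trans (!-reverse-++ W X (subst (e <_) (sym lw) e<i))
                (trans (cong (λ n → W ! (n ∸ suc e)) lw) (cong (W !_) (m∸[m∸n]≡n c′≤i′)))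
    i≤S : i ≤ length S
    i≤S = subst (i ≤_) (sym (trans (length-++ (reverse W)) (cong (_+ length X) (trans (length-reverse W) lw))))
                (m≤m+n i (length X))
    descending⇔ : Ascending W ⇔ DescendingPrefix S i
    descending⇔ = subst (λ n → Ascending W ⇔ DescendingPrefix S n) lw (Ascending⇔DescendingPrefix W X)
    i≤d⇔W↑ : i ≤ descent S ⇔ Ascending W
    i≤d⇔W↑ = ⇔-sym descending⇔ ⇔-∘ ≤descent⇔DescendingPrefix i S i≤S

  window : ℕ → List ℕ → List ℕ
  window p L = take i (drop p L)

  length-window : ∀ L {p} → p + i ≤ length L → length (window p L) ≡ i
  length-window L {p} p+i≤ = length-take-≤ (drop p L)
    (subst (i ≤_) (sym (length-drop p L)) (subst (_≤ length L ∸ p) (m+n∸m≡n p i) (∸-monoˡ-≤ p p+i≤)))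

  reverse-take-window : ∀ L {p q} → p + i ≤ q →
    reverse (take (p + i) (take q L)) ≡ reverse (window p L) ++ reverse (take p L)
  reverse-take-window L {p} {q} p+i≤q = begin
    reverse (take (p + i) (take q L))          ≡⟨ cong reverse (take-take (p + i) q L) ⟩
    reverse (take ((p + i) ⊓ q) L)             ≡⟨ cong (λ s → reverse (take s L)) (m≤n⇒m⊓n≡m p+i≤q) ⟩
    reverse (take (p + i) L)                   ≡⟨ cong reverse (take-+ p i L) ⟩
    reverse (take p L ++ window p L)           ≡⟨ reverse-++ (take p L) (window p L) ⟩
    reverse (window p L) ++ reverse (take p L) ∎
    where open ≡-Reasoning

  WindowLetter : List ℕ → ℕ → ℕ → Set
  WindowLetter L q z = ∃ λ p → p + i ≤ q × Ascending (window p L) × z ≡ window p L ! c′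

  forbiddenAfter : ℕ → List ℕ → List ℕ
  forbiddenAfter q L = forbidden (reverse (take q L))

  ∈ᵇ-forbiddenAfter⇔ : ∀ L {q z} → q ≤ length L → T (z ∈ᵇ forbiddenAfter q L) ⇔ WindowLetter L q z
  ∈ᵇ-forbiddenAfter⇔ L {q} {z} q≤ = mk⇔ to from
    where
    P = take q L
    length-P : length P ≡ q
    length-P = length-take-≤ L q≤
    at-window : ∀ {p} → p + i ≤ q →
      T (z ∈ᵇ newlyForbidden (reverse (take (p + i) P))) ⇔ (Ascending (window p L) × z ≡ window p L ! c′)
    at-window {p} p+i≤q = subst (λ S → T (z ∈ᵇ newlyForbidden S) ⇔ _) (sym (reverse-take-window L p+i≤q))
      (∈ᵇ-newlyForbidden-window⇔ (window p L) (reverse (take p L)) (length-window L (≤-trans p+i≤q q≤)))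
    to : T (z ∈ᵇ forbiddenAfter q L) → WindowLetter L q z
    to z∈ with ∈ᵇ-forbidden-reverse⁻ P z∈
    ... | t , t≤ , z∈t = t ∸ i , p+i≤q , at-window p+i≤q .Equivalence.to z∈p+i
      where
      i≤t : i ≤ t
      i≤t = begin
        i                              ≤⟨ proj₁ (∈ᵇ-newlyForbidden⁻ (reverse (take t P)) z∈t) ⟩
        descent (reverse (take t P))   ≤⟨ descent≤length (reverse (take t P)) ⟩
        length (reverse (take t P))    ≡⟨ length-reverse (take t P) ⟩
        length (take t P)              ≡⟨ length-take t P ⟩
        t ⊓ length P                   ≤⟨ m⊓n≤m t _ ⟩
        t                              ∎
        where open ≤-Reasoning
      p+i≡t : t ∸ i + i ≡ t
      p+i≡t = m∸n+n≡m i≤t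
      p+i≤q : t ∸ i + i ≤ q
      p+i≤q = subst₂ _≤_ (sym p+i≡t) length-P t≤
      z∈p+i : T (z ∈ᵇ newlyForbidden (reverse (take (t ∸ i + i) P)))
      z∈p+i = subst (λ s → T (z ∈ᵇ newlyForbidden (reverse (take s P)))) (sym p+i≡t) z∈t
    from : WindowLetter L q z → T (z ∈ᵇ forbiddenAfter q L)
    from (p , p+i≤q , letter) = ∈ᵇ-forbidden-reverse⁺ P (subst (p + i ≤_) (sym length-P) p+i≤q)
      (at-window p+i≤q .Equivalence.from letter)

  admissible⇔ : ∀ L →
    T (admissibleAfter [] L) ⇔ (∀ {q} → q < length L → ¬ T (L ! q ∈ᵇ forbiddenAfter q L))
  admissible⇔ L = mk⇔
    (λ adm {q} q< → T-not⁻ (subst (λ S → T (allowed S (L ! q))) (++-identityʳ (reverse (take q L)))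
                                   (admissibleAfter⇔ [] L .Equivalence.to adm q<)))
    (λ ok → admissibleAfter⇔ [] L .Equivalence.from λ {q} q< →
      subst (λ S → T (allowed S (L ! q))) (sym (++-identityʳ (reverse (take q L)))) (T-not⁺ (ok q<)))

  c′<i : c′ < i
  c′<i = s≤s c′≤i′

  length-letters : ∀ {n k} (w : Word n k) → length (letters w) ≡ n
  length-letters []ᵥ = refl
  length-letters (x ∷ᵥ w) = cong suc (length-letters w)

  toℕ-lookup : ∀ {n k} (w : Word n k) (q : Fin n) → toℕ (lookup w q) ≡ letters w ! toℕ q
  toℕ-lookup (x ∷ᵥ w) fzero = refl
  toℕ-lookup (x ∷ᵥ w) (fsuc q) = toℕ-lookup w q

  module _ {n k} (w : Word n k) where
    private
      L = letters w

    Occurs⇔WindowLetter : Occurs i (suc c′) w ⇔ (∃ λ q → q < length L × WindowLetter L q (L ! q))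
    Occurs⇔WindowLetter = mk⇔ to from
      where
      to : Occurs i (suc c′) w → ∃ λ q → q < length L × WindowLetter L q (L ! q)
      to (P , Q , p+i≤q , E) = toℕ Q , q<L , toℕ P , p+i≤q ,
        red≡patWord⇒ (window (toℕ P) L) (length-window L (≤-trans p+i≤q (<⇒≤ q<L))) c′<i E′
        where
        q<L : toℕ Q < length L
        q<L = subst (toℕ Q <_) (sym (length-letters w)) (toℕ<n Q)
        E′ : red (window (toℕ P) L ++ L ! toℕ Q ∷ []) ≡ patWord i (suc c′)
        E′ = subst (λ y → red (window (toℕ P) L ++ y ∷ []) ≡ patWord i (suc c′)) (toℕ-lookup w Q)
               (trans E (red-patWord c′<i))
      from : (∃ λ q → q < length L × WindowLetter L q (L ! q)) → Occurs i (suc c′) w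
      from (q , q<L , p , p+i≤q , W↑ , y≡) =
        P , Q , subst₂ (λ a b → a + i ≤ b) (sym toℕ-P) (sym toℕ-Q) p+i≤q , E
        where
        q<n = subst (q <_) (length-letters w) q<L
        p<n = ≤-<-trans (≤-trans (m≤m+n p i) p+i≤q) q<n
        P Q : Fin n
        P = fromℕ< p<n
        Q = fromℕ< q<n
        toℕ-P : toℕ P ≡ p
        toℕ-P = toℕ-fromℕ< p<n
        toℕ-Q : toℕ Q ≡ q
        toℕ-Q = toℕ-fromℕ< q<n
        E : red (window (toℕ P) L ++ toℕ (lookup w Q) ∷ []) ≡ red (patWord i (suc c′))
        E = begin
          red (window (toℕ P) L ++ toℕ (lookup w Q) ∷ [])
            ≡⟨ cong₂ (λ p′ y → red (window p′ L ++ y ∷ [])) toℕ-P (trans (toℕ-lookup w Q) (cong (L !_) toℕ-Q)) ⟩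
          red (window p L ++ L ! q ∷ [])
            ≡⟨ red-ascending-snoc (window p L) (length-window L (≤-trans p+i≤q (<⇒≤ q<L))) W↑ c′<i y≡ ⟩
          patWord i (suc c′)
            ≡⟨ red-patWord c′<i ⟨
          red (patWord i (suc c′)) ∎
          where open ≡-Reasoning

    Avoids⇔admissible : Avoids i (suc c′) w ⇔ T (admissibleAfter [] L)
    Avoids⇔admissible = mk⇔
      (λ avoids → admissible⇔ L .Equivalence.from λ {q} q<L q∈ →
         avoids (Occurs⇔WindowLetter .Equivalence.from
                  (q , q<L , ∈ᵇ-forbiddenAfter⇔ L (<⇒≤ q<L) .Equivalence.to q∈)))
      (λ adm occ → let (q , q<L , letter) = Occurs⇔WindowLetter .Equivalence.to occ in
         admissible⇔ L .Equivalence.to adm q<L (∈ᵇ-forbiddenAfter⇔ L (<⇒≤ q<L) .Equivalence.from letter))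

  avoiders≡continuations : ∀ n k → a i (suc c′) n k ≡ continuations i n (countBelow k (λ _ → true)) 0 0
  avoiders≡continuations n k = begin
    a i (suc c′) n k
      ≡⟨ length-filter≡countᵇ (avoids? i (suc c′)) (admissibleAfter [] ∘ letters) Avoids⇔admissible (allWords n k) ⟩
    Counting.admissibleCount k [] n
      ≡⟨ Counting.admissibleCount≡continuationsFrom k n [] tt [] ⟩
    continuations i n (countBelow k (λ _ → true)) 0 0 ∎
    where open ≡-Reasoning

theorem2p3 : (i c d : ℕ) → 2 ≤ i → 1 ≤ c → c ≤ i → 1 ≤ d → d ≤ i →
    WilfEquiv i c d
theorem2p3 (suc i′) (suc c′) (suc d′) _ _ (s≤s c′≤i′) _ (s≤s d′≤i′) n k _ = begin
  a (suc i′) (suc c′) n k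
    ≡⟨ Forbidden.avoiders≡continuations i′ c′ c′≤i′ n k ⟩
  continuations (suc i′) n (countBelow k (λ _ → true)) 0 0
    ≡⟨ Forbidden.avoiders≡continuations i′ d′ d′≤i′ n k ⟨
  a (suc i′) (suc d′) n k ∎
  where open ≡-Reasoning
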